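{- Let $\gamma$ denote the maximum value of the function \[ f(x)=\frac{x^2}{2}\left(\frac{x^2}{2}+\frac{(1-x)^2}{2}\right)\left(x(1-x)+\frac{(1-x)^2}{2}\right) \] over $x\in[0,1]$. Then there exist graphs $G_1,G_2,G_3$ on a common vertex set of size $n$ with no rainbow triangle such that \[ e(G_1)e(G_2)e(G_3)\ge \gamma n^6(1-o(1)), \] where $o(1)$ denotes a quantity tending to $0$ as $n\to\infty$; that is, there is a function $\varepsilon(n)\to 0$ such that for every $n$ there are such graphs with $e(G_1)e(G_2)e(G_3)\ge \gamma n^6(1-\varepsilon(n))$.
   Context: All graphs are simple. For a graph $G$, $e(G)=|E(G)|$ is its number of edges. Given graphs $G_1,G_2,G_3$ on a common vertex set, a rainbow triangle is a set of three distinct vertices $u,v,w$ such that the three edges $uv, vw, uw$ can be assigned to $G_1,G_2,G_3$ bijectively, each edge lying in the edge set of the graph it is assigned to (i.e., the triangle consists of one edge from each $G_i$). -}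

module Defs where

open import Data.Nat as ℕ using (ℕ; _<?_)
open import Data.Fin using (Fin; toℕ)
open import Data.Bool using (Bool; T; true; false)
open import Data.Bool.Properties using (T?)
open import Data.List using (List; length; filter; cartesianProduct; allFin)
open import Data.Product using (_×_; _,_; proj₁; proj₂)
open import Relation.Nullary using (¬_)
open import Relation.Nullary.Decidable using (_×-dec_)
open import Relation.Binary.PropositionalEquality using (_≡_; _≢_)
open import Data.Integer using (+_)
open import Data.Rational using (ℚ; _+_; _*_; _-_; ½; 1ℚ; _/_)

record Graph (n : ℕ) : Set where
  field
    adj    : Fin n → Fin n → Bool
    sym    : ∀ u v → adj u v ≡ adj v u
    irrefl : ∀ v → adj v v ≡ false
open Graph public

Adj : ∀ {n} → Graph n → Fin n → Fin n → Set
Adj G u v = T (adj G u v)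

e : ∀ {n} → Graph n → ℕ
e {n} G = length (filter (λ p → (toℕ (proj₁ p) <? toℕ (proj₂ p)) ×-dec T? (adj G (proj₁ p) (proj₂ p)))
                         (cartesianProduct (allFin n) (allFin n)))

-- A rainbow triangle: distinct u, v, w with uv ∈ G₁, vw ∈ G₂, uw ∈ G₃.
-- (Quantifying over all ordered triples covers every bijective assignment
-- of the three triangle edges to G₁, G₂, G₃, since graphs are symmetric.)
RainbowTriangle : ∀ {n} → Graph n → Graph n → Graph n → Set
RainbowTriangle {n} G₁ G₂ G₃ =
  Data.Product.Σ (Fin n) λ u → Data.Product.Σ (Fin n) λ v → Data.Product.Σ (Fin n) λ w →
    (u ≢ v) × (v ≢ w) × (u ≢ w) × Adj G₁ u v × Adj G₂ v w × Adj G₃ u w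

NoRainbowTriangle : ∀ {n} → Graph n → Graph n → Graph n → Set
NoRainbowTriangle G₁ G₂ G₃ = ¬ RainbowTriangle G₁ G₂ G₃

f : ℚ → ℚ
f x = (½ * (x * x)) * ((½ * (x * x)) + (½ * ((1ℚ - x) * (1ℚ - x))))
        * ((x * (1ℚ - x)) + (½ * ((1ℚ - x) * (1ℚ - x))))

ℕ→ℚ : ℕ → ℚ
ℕ→ℚ m = (+ m) / 1

{-# OPTIONS --safe #-}
module Submission where

-- Split the vertices into A = {0,…,a-1} and B = {a,…,n-1}; let G₁ be the
-- clique on A, G₂ the union of the cliques on A and on B, and G₃ the set of
-- pairs meeting B. Edges uv ∈ G₁ and vw ∈ G₂ force u, v, w ∈ A, so uw ∉ G₃:
-- there is no rainbow triangle. With a = ⌊xn⌋ the three edge counts are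
-- x²n²/2, (x² + (1-x)²)n²/2 and (x(1-x) + (1-x)²/2)n² up to O(n), so
-- f(x)n⁶ ≤ e(G₁)e(G₂)e(G₃) + O(n⁵). Taking the split that maximises the
-- product makes this hold for all x at once, and since the product is then at
-- least f(½)n⁶ - O(n⁵), the O(n⁵) error is an ε-fraction of it for large n.

module EdgeCounting where

  open import Data.Bool.Base using (Bool; true; false; not; _∧_)
  open import Data.Fin.Base using (Fin; toℕ)
  open import Data.List.Base using (_∷_; []; _++_; map; filter; length; applyUpTo; tabulate; allFin; cartesianProduct)
  open import Data.List.Properties using (map-++; map-∘; map-cong; map-tabulate)
  open import Data.Nat.Base
  open import Data.Nat.Properties using (+-assoc)
  open import Data.Nat.ListAction using (sum)
  open import Data.Nat.ListAction.Properties using (sum-++)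
  open import Data.Nat.Tactic.RingSolver using (solve-∀)
  open import Data.Product.Base using (_×_; _,_)
  open import Function.Base using (_∘_)
  open import Relation.Nullary using (does)
  open import Relation.Unary using (Pred; Decidable)
  open import Relation.Binary.PropositionalEquality
  open import Defs using (Graph; adj; e)
  open ≡-Reasoning

  iverson : Bool → ℕ
  iverson true  = 1
  iverson false = 0

  ∑ : ℕ → (ℕ → ℕ) → ℕ
  ∑ n φ = sum (applyUpTo φ n)

  syntax ∑ n (λ i → φ) = ∑[ i < n ] φ

  length-filter : ∀ {A : Set} {p} {P : Pred A p} (P? : Decidable P) xs →
                  length (filter P? xs) ≡ sum (map (iverson ∘ does ∘ P?) xs)
  length-filter P? []       = refl
  length-filter P? (x ∷ xs) with does (P? x)
  ... | true  = cong suc (length-filter P? xs)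
  ... | false = length-filter P? xs

  sum-map-cartesianProduct : ∀ {A B : Set} (w : A × B → ℕ) xs ys →
    sum (map w (cartesianProduct xs ys)) ≡ sum (map (λ x → sum (map (λ y → w (x , y)) ys)) xs)
  sum-map-cartesianProduct w []       ys = refl
  sum-map-cartesianProduct w (x ∷ xs) ys = begin
    sum (map w (map (x ,_) ys ++ cartesianProduct xs ys))
      ≡⟨ cong sum (map-++ w (map (x ,_) ys) _) ⟩
    sum (map w (map (x ,_) ys) ++ map w (cartesianProduct xs ys))
      ≡⟨ sum-++ (map w (map (x ,_) ys)) _ ⟩
    sum (map w (map (x ,_) ys)) + sum (map w (cartesianProduct xs ys))
      ≡⟨ cong₂ _+_ (cong sum (sym (map-∘ ys))) (sum-map-cartesianProduct w xs ys) ⟩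
    sum (map (λ y → w (x , y)) ys) + sum (map (λ x → sum (map (λ y → w (x , y)) ys)) xs) ∎

  tabulate-toℕ : ∀ n (φ : ℕ → ℕ) → tabulate {n = n} (φ ∘ toℕ) ≡ applyUpTo φ n
  tabulate-toℕ zero    φ = refl
  tabulate-toℕ (suc n) φ = cong (φ 0 ∷_) (tabulate-toℕ n (φ ∘ suc))

  sum-map-allFin : ∀ n (φ : ℕ → ℕ) → sum (map (φ ∘ toℕ) (allFin n)) ≡ ∑[ i < n ] φ i
  sum-map-allFin n φ = cong sum (trans (map-tabulate (λ i → i) (φ ∘ toℕ)) (tabulate-toℕ n φ))

  edges : ℕ → (ℕ → ℕ → Bool) → ℕ
  edges n Q = ∑[ i < n ] ∑[ j < n ] iverson ((i <ᵇ j) ∧ Q i j)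

  e≡edges : ∀ {n} (G : Graph n) (Q : ℕ → ℕ → Bool) →
            (∀ i j → adj G i j ≡ Q (toℕ i) (toℕ j)) → e G ≡ edges n Q
  e≡edges {n} G Q adj≡Q = begin
    e G
      ≡⟨ length-filter _ (cartesianProduct (allFin n) (allFin n)) ⟩
    sum (map w (cartesianProduct (allFin n) (allFin n)))
      ≡⟨ sum-map-cartesianProduct w (allFin n) (allFin n) ⟩
    sum (map (λ i → sum (map (λ j → w (i , j)) (allFin n))) (allFin n))
      ≡⟨ cong sum (map-cong row (allFin n)) ⟩
    sum (map (λ i → ∑[ j < n ] iverson ((toℕ i <ᵇ j) ∧ Q (toℕ i) j)) (allFin n))
      ≡⟨ sum-map-allFin n (λ i → ∑[ j < n ] iverson ((i <ᵇ j) ∧ Q i j)) ⟩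
    edges n Q ∎
    where
    w : Fin n × Fin n → ℕ
    w (i , j) = iverson ((toℕ i <ᵇ toℕ j) ∧ adj G i j)
    row : ∀ i → sum (map (λ j → w (i , j)) (allFin n)) ≡ ∑[ j < n ] iverson ((toℕ i <ᵇ j) ∧ Q (toℕ i) j)
    row i = trans (cong sum (map-cong (λ j → cong (λ b → iverson ((toℕ i <ᵇ toℕ j) ∧ b)) (adj≡Q i j)) (allFin n)))
                  (sum-map-allFin n (λ j → iverson ((toℕ i <ᵇ j) ∧ Q (toℕ i) j)))

  ∑-threshold : ∀ a b (g : Bool → ℕ) → ∑[ j < a + b ] g (j <ᵇ a) ≡ a * g true + b * g false
  ∑-threshold zero    zero    g = refl
  ∑-threshold zero    (suc b) g = cong (g false +_) (∑-threshold zero b g)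
  ∑-threshold (suc a) b       g = trans (cong (g true +_) (∑-threshold a b g)) (sym (+-assoc (g true) _ _))

  -- Vertex i lies in part A iff i < a; φ says which of the pairs AA, AB, BB are edges.
  blowupAdj : ℕ → (Bool → Bool → Bool) → ℕ → ℕ → Bool
  blowupAdj a φ i j = not (i ≡ᵇ j) ∧ φ (i <ᵇ a) (j <ᵇ a)

  -- φ false true never counts: a pair i < j with j in A has i in A too.
  edges-blowup : ∀ (φ : Bool → Bool → Bool) a b →
    2 * edges (a + b) (blowupAdj a φ) + (a * iverson (φ true true) + b * iverson (φ false false))
      ≡ a * a * iverson (φ true true) + 2 * (a * b * iverson (φ true false)) + b * b * iverson (φ false false)
  edges-blowup φ zero zero = refl
  edges-blowup φ zero (suc b) = begin
    2 * (∑[ j < b ] s + E) + suc b * s   ≡⟨ cong (λ r → 2 * (r + E) + suc b * s) (∑-threshold 0 b (λ _ → s)) ⟩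
    2 * (b * s + E) + suc b * s          ≡⟨ split E b s ⟩
    (2 * E + b * s) + (2 * (b * s) + s)  ≡⟨ cong (_+ (2 * (b * s) + s)) (edges-blowup φ zero b) ⟩
    b * b * s + (2 * (b * s) + s)        ≡⟨ merge b s ⟩
    suc b * suc b * s                    ∎
    where
    s = iverson (φ false false)
    E = edges b (blowupAdj 0 φ)
    split : ∀ E b s → 2 * (b * s + E) + suc b * s ≡ (2 * E + b * s) + (2 * (b * s) + s)
    split = solve-∀
    merge : ∀ b s → b * b * s + (2 * (b * s) + s) ≡ suc b * suc b * s
    merge = solve-∀
  edges-blowup φ (suc a) b = begin
    2 * (∑[ j < a + b ] iverson (φ true (j <ᵇ a)) + E) + (suc a * t + b * s)
      ≡⟨ cong (λ r → 2 * (r + E) + (suc a * t + b * s)) (∑-threshold a b (iverson ∘ φ true)) ⟩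
    2 * ((a * t + b * m) + E) + (suc a * t + b * s)
      ≡⟨ split E a b t m s ⟩
    (2 * E + (a * t + b * s)) + (2 * (a * t) + 2 * (b * m) + t)
      ≡⟨ cong (_+ (2 * (a * t) + 2 * (b * m) + t)) (edges-blowup φ a b) ⟩
    (a * a * t + 2 * (a * b * m) + b * b * s) + (2 * (a * t) + 2 * (b * m) + t)
      ≡⟨ merge a b t m s ⟩
    suc a * suc a * t + 2 * (suc a * b * m) + b * b * s ∎
    where
    t = iverson (φ true true)
    m = iverson (φ true false)
    s = iverson (φ false false)
    E = edges (a + b) (blowupAdj a φ)
    split : ∀ E a b t m s → 2 * ((a * t + b * m) + E) + (suc a * t + b * s)
                          ≡ (2 * E + (a * t + b * s)) + (2 * (a * t) + 2 * (b * m) + t)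
    split = solve-∀
    merge : ∀ a b t m s → (a * a * t + 2 * (a * b * m) + b * b * s) + (2 * (a * t) + 2 * (b * m) + t)
                        ≡ suc a * suc a * t + 2 * (suc a * b * m) + b * b * s
    merge = solve-∀

module ThresholdGraphs where

  open import Data.Bool.Base using (Bool; true; false; not; _∧_; _xor_; T)
  open import Data.Bool.Properties using (∧-comm; xor-comm; T-∧)
  open import Data.Empty using (⊥)
  open import Data.Fin.Base using (toℕ)
  open import Data.Nat.Base
  open import Data.Nat.Tactic.RingSolver using (solve-∀)
  open import Data.Product.Base using (_,_; proj₂)
  open import Function.Base using (_∘′_)
  open import Function.Bundles using (Equivalence)
  open import Relation.Binary.PropositionalEquality
  open import Algebra.Definitions {A = Bool} _≡_ using (Commutative)
  open import Defs using (Graph; e; NoRainbowTriangle)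
  open EdgeCounting
  open ≡-Reasoning

  ≡ᵇ-sym : ∀ i j → (i ≡ᵇ j) ≡ (j ≡ᵇ i)
  ≡ᵇ-sym zero    zero    = refl
  ≡ᵇ-sym zero    (suc j) = refl
  ≡ᵇ-sym (suc i) zero    = refl
  ≡ᵇ-sym (suc i) (suc j) = ≡ᵇ-sym i j

  ≡ᵇ-refl : ∀ i → (i ≡ᵇ i) ≡ true
  ≡ᵇ-refl zero    = refl
  ≡ᵇ-refl (suc i) = ≡ᵇ-refl i

  blowup : ∀ n → ℕ → (φ : Bool → Bool → Bool) → Commutative φ → Graph n
  blowup n a φ φ-comm = record
    { adj    = λ u v → blowupAdj a φ (toℕ u) (toℕ v)
    ; sym    = λ u v → cong₂ _∧_ (cong not (≡ᵇ-sym (toℕ u) (toℕ v))) (φ-comm _ _)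
    ; irrefl = λ v → cong (λ b → not b ∧ φ (toℕ v <ᵇ a) (toℕ v <ᵇ a)) (≡ᵇ-refl (toℕ v))
    }

  e-blowup : ∀ {n} a φ φ-comm → e (blowup n a φ φ-comm) ≡ edges n (blowupAdj a φ)
  e-blowup {n} a φ φ-comm = e≡edges (blowup n a φ φ-comm) (blowupAdj a φ) (λ _ _ → refl)

  RainbowFree : (φ₁ φ₂ φ₃ : Bool → Bool → Bool) → Set
  RainbowFree φ₁ φ₂ φ₃ = ∀ x y z → T (φ₁ x y) → T (φ₂ y z) → T (φ₃ x z) → ⊥

  blowup-noRainbowTriangle : ∀ {φ₁ φ₂ φ₃ s₁ s₂ s₃} n a → RainbowFree φ₁ φ₂ φ₃ →
    NoRainbowTriangle (blowup n a φ₁ s₁) (blowup n a φ₂ s₂) (blowup n a φ₃ s₃)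
  blowup-noRainbowTriangle n a free (u , v , w , _ , _ , _ , uv , vw , uw) =
    free _ _ _ (inPattern uv) (inPattern vw) (inPattern uw)
    where
    inPattern : ∀ {b c} → T (b ∧ c) → T c
    inPattern = proj₂ ∘′ Equivalence.to T-∧

  insideA sameSide touchesB : Bool → Bool → Bool
  insideA  = _∧_
  sameSide x y = not (x xor y)
  touchesB x y = not (x ∧ y)

  rainbowFree : RainbowFree insideA sameSide touchesB
  rainbowFree true  true  true  _  _  ()
  rainbowFree true  true  false _  () _
  rainbowFree true  false _     () _  _
  rainbowFree false _     _     () _  _

  sameSide-comm : Commutative sameSide
  sameSide-comm x y = cong not (xor-comm x y)

  touchesB-comm : Commutative touchesB
  touchesB-comm x y = cong not (∧-comm x y)

  G₁ G₂ G₃ : ∀ n → ℕ → Graph n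
  G₁ n a = blowup n a insideA  ∧-comm
  G₂ n a = blowup n a sameSide sameSide-comm
  G₃ n a = blowup n a touchesB touchesB-comm

  noRainbowTriangle : ∀ n a → NoRainbowTriangle (G₁ n a) (G₂ n a) (G₃ n a)
  noRainbowTriangle n a = blowup-noRainbowTriangle {s₁ = ∧-comm} {sameSide-comm} {touchesB-comm} n a rainbowFree

  e-G₁ : ∀ {n} a b → a + b ≡ n → 2 * e (G₁ n a) + a ≡ a * a
  e-G₁ a b refl = begin
    2 * e (G₁ (a + b) a) + a                  ≡⟨ cong (λ k → 2 * k + a) (e-blowup {a + b} a insideA ∧-comm) ⟩
    2 * E + a                                 ≡⟨ weights E a b ⟩
    2 * E + (a * 1 + b * 0)                   ≡⟨ edges-blowup insideA a b ⟩
    a * a * 1 + 2 * (a * b * 0) + b * b * 0   ≡⟨ value a b ⟩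
    a * a                                     ∎
    where
    E = edges (a + b) (blowupAdj a insideA)
    weights : ∀ E a b → 2 * E + a ≡ 2 * E + (a * 1 + b * 0)
    weights = solve-∀
    value : ∀ a b → a * a * 1 + 2 * (a * b * 0) + b * b * 0 ≡ a * a
    value = solve-∀

  e-G₂ : ∀ {n} a b → a + b ≡ n → 2 * e (G₂ n a) + (a + b) ≡ a * a + b * b
  e-G₂ a b refl = begin
    2 * e (G₂ (a + b) a) + (a + b)            ≡⟨ cong (λ k → 2 * k + (a + b)) (e-blowup {a + b} a sameSide sameSide-comm) ⟩
    2 * E + (a + b)                           ≡⟨ weights E a b ⟩
    2 * E + (a * 1 + b * 1)                   ≡⟨ edges-blowup sameSide a b ⟩
    a * a * 1 + 2 * (a * b * 0) + b * b * 1   ≡⟨ value a b ⟩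
    a * a + b * b                             ∎
    where
    E = edges (a + b) (blowupAdj a sameSide)
    weights : ∀ E a b → 2 * E + (a + b) ≡ 2 * E + (a * 1 + b * 1)
    weights = solve-∀
    value : ∀ a b → a * a * 1 + 2 * (a * b * 0) + b * b * 1 ≡ a * a + b * b
    value = solve-∀

  e-G₃ : ∀ {n} a b → a + b ≡ n → 2 * e (G₃ n a) + b ≡ b * b + 2 * (a * b)
  e-G₃ a b refl = begin
    2 * e (G₃ (a + b) a) + b                  ≡⟨ cong (λ k → 2 * k + b) (e-blowup {a + b} a touchesB touchesB-comm) ⟩
    2 * E + b                                 ≡⟨ weights E a b ⟩
    2 * E + (a * 0 + b * 1)                   ≡⟨ edges-blowup touchesB a b ⟩
    a * a * 0 + 2 * (a * b * 1) + b * b * 1   ≡⟨ value a b ⟩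
    b * b + 2 * (a * b)                       ∎
    where
    E = edges (a + b) (blowupAdj a touchesB)
    weights : ∀ E a b → 2 * E + b ≡ 2 * E + (a * 0 + b * 1)
    weights = solve-∀
    value : ∀ a b → a * a * 0 + 2 * (a * b * 1) + b * b * 1 ≡ b * b + 2 * (a * b)
    value = solve-∀

module NatBounds where

  open import Data.Nat.Base
  open import Data.Nat.Properties
  open import Data.Nat.Tactic.RingSolver using (solve-∀)
  open import Relation.Binary.PropositionalEquality
  open ≤-Reasoning

  ≤-witness : ∀ {m n} k → m + k ≡ n → m ≤ n
  ≤-witness k refl = m≤m+n _ k

  product-perturb : ∀ {u₁ u₂ u₃ v₁ v₂ v₃ d₁ d₂ d₃ m} →
    u₁ ≡ v₁ + d₁ → u₂ ≡ v₂ + d₂ → u₃ ≡ v₃ + d₃ → u₁ ≤ m → u₂ ≤ m → u₃ ≤ m →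
    u₁ * u₂ * u₃ ≤ v₁ * v₂ * v₃ + (d₁ + d₂ + d₃) * (m * m)
  product-perturb {v₁ = v₁} {v₂} {v₃} {d₁} {d₂} {d₃} {m} refl refl refl u₁≤m u₂≤m u₃≤m = begin
    (v₁ + d₁) * (v₂ + d₂) * (v₃ + d₃)
      ≡⟨ expand v₁ v₂ v₃ d₁ d₂ d₃ ⟩
    v₁ * v₂ * v₃ + (d₁ * ((v₂ + d₂) * (v₃ + d₃)) + d₂ * (v₁ * (v₃ + d₃)) + d₃ * (v₁ * v₂))
      ≤⟨ +-monoʳ-≤ (v₁ * v₂ * v₃) (+-mono-≤ (+-mono-≤ (*-monoʳ-≤ d₁ (*-mono-≤ u₂≤m u₃≤m))
                                                      (*-monoʳ-≤ d₂ (*-mono-≤ v₁≤m u₃≤m)))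
                                           (*-monoʳ-≤ d₃ (*-mono-≤ v₁≤m v₂≤m))) ⟩
    v₁ * v₂ * v₃ + (d₁ * (m * m) + d₂ * (m * m) + d₃ * (m * m))
      ≡⟨ cong (v₁ * v₂ * v₃ +_) (collect d₁ d₂ d₃ (m * m)) ⟩
    v₁ * v₂ * v₃ + (d₁ + d₂ + d₃) * (m * m) ∎
    where
    v₁≤m = ≤-trans (m≤m+n v₁ d₁) u₁≤m
    v₂≤m = ≤-trans (m≤m+n v₂ d₂) u₂≤m
    expand : ∀ v₁ v₂ v₃ d₁ d₂ d₃ → (v₁ + d₁) * (v₂ + d₂) * (v₃ + d₃)
           ≡ v₁ * v₂ * v₃ + (d₁ * ((v₂ + d₂) * (v₃ + d₃)) + d₂ * (v₁ * (v₃ + d₃)) + d₃ * (v₁ * v₂))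
    expand = solve-∀
    collect : ∀ d₁ d₂ d₃ M → d₁ * M + d₂ * M + d₃ * M ≡ (d₁ + d₂ + d₃) * M
    collect = solve-∀

  -- 8 · f(x) n⁶ = edgePolyℕ (x n) ((1 - x) n)
  edgePolyℕ : ℕ → ℕ → ℕ
  edgePolyℕ p q = p * p * (p * p + q * q) * (p * q + p * q + q * q)

  errorTerm : ℕ → ℕ
  errorTerm n = suc n ^ 5

  factor₁-≡ : ∀ {e₁} a → 2 * e₁ + a ≡ a * a → suc a * suc a ≡ 2 * e₁ + (3 * a + 1)
  factor₁-≡ {e₁} a h = +-cancelʳ-≡ (2 * e₁ + a) _ _ (trans (identity e₁ a) (cong (2 * e₁ + (3 * a + 1) +_) (sym h)))
    where
    identity : ∀ e a → suc a * suc a + (2 * e + a) ≡ 2 * e + (3 * a + 1) + a * a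
    identity = solve-∀

  factor₂-≡ : ∀ {e₂} a b → 2 * e₂ + (a + b) ≡ a * a + b * b →
              suc a * suc a + b * b ≡ 2 * e₂ + ((a + b) + 2 * a + 1)
  factor₂-≡ {e₂} a b h =
    +-cancelʳ-≡ (2 * e₂ + (a + b)) _ _ (trans (identity e₂ a b) (cong (2 * e₂ + ((a + b) + 2 * a + 1) +_) (sym h)))
    where
    identity : ∀ e a b → suc a * suc a + b * b + (2 * e + (a + b)) ≡ 2 * e + ((a + b) + 2 * a + 1) + (a * a + b * b)
    identity = solve-∀

  factor₃-≡ : ∀ {e₃} a b → 2 * e₃ + b ≡ b * b + 2 * (a * b) → suc a * b + suc a * b + b * b ≡ 2 * e₃ + 3 * b
  factor₃-≡ {e₃} a b h = +-cancelʳ-≡ (2 * e₃ + b) _ _ (trans (identity e₃ a b) (cong (2 * e₃ + 3 * b +_) (sym h)))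
    where
    identity : ∀ e a b → suc a * b + suc a * b + b * b + (2 * e + b) ≡ 2 * e + 3 * b + (b * b + 2 * (a * b))
    identity = solve-∀

  edgePolyℕ-≤ : ∀ {e₁ e₂ e₃} a b → 2 * e₁ + a ≡ a * a → 2 * e₂ + (a + b) ≡ a * a + b * b →
    2 * e₃ + b ≡ b * b + 2 * (a * b) → edgePolyℕ (suc a) b ≤ 8 * (e₁ * e₂ * e₃ + errorTerm (a + b))
  edgePolyℕ-≤ {e₁} {e₂} {e₃} a b h₁ h₂ h₃ = begin
    edgePolyℕ (suc a) b
      ≤⟨ product-perturb {v₁ = 2 * e₁} {2 * e₂} {2 * e₃} {d₁} {d₂} {d₃}
           (factor₁-≡ {e₁} a h₁) (factor₂-≡ {e₂} a b h₂) (factor₃-≡ {e₃} a b h₃) factor₁-≤ factor₂-≤ factor₃-≤ ⟩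
    2 * e₁ * (2 * e₂) * (2 * e₃) + (d₁ + d₂ + d₃) * (m * m)
      ≤⟨ +-monoʳ-≤ (2 * e₁ * (2 * e₂) * (2 * e₃)) (*-monoˡ-≤ (m * m) {d₁ + d₂ + d₃} (≤-witness (2 * a + 4 * b + 6) (slack a b))) ⟩
    2 * e₁ * (2 * e₂) * (2 * e₃) + 8 * suc (a + b) * (m * m)
      ≡⟨ regroup e₁ e₂ e₃ (suc (a + b)) ⟩
    8 * (e₁ * e₂ * e₃ + errorTerm (a + b)) ∎
    where
    d₁ = 3 * a + 1
    d₂ = (a + b) + 2 * a + 1
    d₃ = 3 * b
    m = suc (a + b) * suc (a + b)
    factor₂-≤ : suc a * suc a + b * b ≤ m
    factor₂-≤ = ≤-witness (suc a * b + suc a * b) (square a b)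
      where
      square : ∀ a b → suc a * suc a + b * b + (suc a * b + suc a * b) ≡ suc (a + b) * suc (a + b)
      square = solve-∀
    factor₁-≤ : suc a * suc a ≤ m
    factor₁-≤ = ≤-trans (m≤m+n (suc a * suc a) (b * b)) factor₂-≤
    factor₃-≤ : suc a * b + suc a * b + b * b ≤ m
    factor₃-≤ = ≤-witness (suc a * suc a) (square a b)
      where
      square : ∀ a b → suc a * b + suc a * b + b * b + suc a * suc a ≡ suc (a + b) * suc (a + b)
      square = solve-∀
    slack : ∀ a b → 3 * a + 1 + ((a + b) + 2 * a + 1) + 3 * b + (2 * a + 4 * b + 6) ≡ 8 * suc (a + b)
    slack = solve-∀
    regroup : ∀ e₁ e₂ e₃ s → 2 * e₁ * (2 * e₂) * (2 * e₃) + 8 * s * (s * s * (s * s))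
                           ≡ 8 * (e₁ * e₂ * e₃ + s * (s * (s * (s * (s * 1)))))
    regroup = solve-∀

  -- (n + 1)⁵ ≤ 32 n⁵ and f(½) = 3/256, whence the threshold 8192 = 256 · 32.
  errorTerm-small : ∀ k n → 8192 * suc k ≤ n → 256 * (k * errorTerm n + errorTerm n) ≤ 3 * n ^ 6
  errorTerm-small k n h = begin
    256 * (k * suc n ^ 5 + suc n ^ 5)   ≡⟨ cong (256 *_) (+-comm (k * suc n ^ 5) _) ⟩
    256 * (suc k * suc n ^ 5)           ≤⟨ *-monoʳ-≤ 256 (*-monoʳ-≤ (suc k) (^-monoˡ-≤ 5 suc-n≤2n)) ⟩
    256 * (suc k * (2 * n) ^ 5)         ≡⟨ regroup k n ⟩
    8192 * suc k * n ^ 5                ≤⟨ *-monoˡ-≤ (n ^ 5) h ⟩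
    n * n ^ 5                           ≤⟨ m≤n*m (n * n ^ 5) 3 ⟩
    3 * n ^ 6                           ∎
    where
    suc-n≤2n : suc n ≤ 2 * n
    suc-n≤2n = ≤-trans (+-monoˡ-≤ n (≤-trans (s≤s z≤n) h)) (≤-reflexive (cong (n +_) (sym (+-identityʳ n))))
    regroup : ∀ k n → 256 * (suc k * (2 * n * (2 * n * (2 * n * (2 * n * (2 * n * 1))))))
                    ≡ 8192 * suc k * (n * (n * (n * (n * (n * 1)))))
    regroup = solve-∀

module RationalBounds where

  open import Data.Integer.Base as ℤ using (+_; +[1+_]; -[1+_])
  import Data.Integer.Properties as ℤ
  open import Data.Nat.Base as ℕ using (ℕ; zero; suc)
  import Data.Nat.Properties as ℕ
  open import Data.Nat.Coprimality using (1-coprimeTo) renaming (sym to coprime-sym)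
  open import Data.Product.Base using (Σ; _×_; _,_)
  open import Data.Rational.Base
  open import Data.Rational.Properties
  open import Algebra.Definitions.RawSemiring +-*-rawSemiring using (_^_)
  open import Data.Rational.Solver using (module +-*-Solver)
  open import Relation.Binary.PropositionalEquality
  open import Relation.Nullary using (yes; no)
  open import Defs using (f; ℕ→ℚ)
  open NatBounds using (edgePolyℕ; edgePolyℕ-≤; errorTerm; errorTerm-small)
  open +-*-Solver

  -- On these canonical forms ℚ's _+_ and _*_ unfold to a normalisation over denominator 1.
  ℕ→ℚ≡mkℚ : ∀ m → ℕ→ℚ m ≡ mkℚ (+ m) 0 (coprime-sym (1-coprimeTo m))
  ℕ→ℚ≡mkℚ m = normalize-coprime (coprime-sym (1-coprimeTo m))

  ℕ→ℚ-+ : ∀ m k → ℕ→ℚ (m ℕ.+ k) ≡ ℕ→ℚ m + ℕ→ℚ k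
  ℕ→ℚ-+ m k = begin
    + (m ℕ.+ k) / 1                        ≡⟨ cong (_/ 1) (cong₂ ℤ._+_ (sym (ℤ.*-identityʳ (+ m))) (sym (ℤ.*-identityʳ (+ k)))) ⟩
    (+ m ℤ.* + 1 ℤ.+ + k ℤ.* + 1) / 1      ≡⟨ cong₂ _+_ (sym (ℕ→ℚ≡mkℚ m)) (sym (ℕ→ℚ≡mkℚ k)) ⟩
    ℕ→ℚ m + ℕ→ℚ k                          ∎
    where open ≡-Reasoning

  ℕ→ℚ-* : ∀ m k → ℕ→ℚ (m ℕ.* k) ≡ ℕ→ℚ m * ℕ→ℚ k
  ℕ→ℚ-* m k = begin
    + (m ℕ.* k) / 1     ≡⟨ cong (_/ 1) (ℤ.pos-* m k) ⟩
    (+ m ℤ.* + k) / 1   ≡⟨ cong₂ _*_ (sym (ℕ→ℚ≡mkℚ m)) (sym (ℕ→ℚ≡mkℚ k)) ⟩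
    ℕ→ℚ m * ℕ→ℚ k       ∎
    where open ≡-Reasoning

  ℕ→ℚ-^ : ∀ m k → ℕ→ℚ (m ℕ.^ k) ≡ ℕ→ℚ m ^ k
  ℕ→ℚ-^ m zero    = refl
  ℕ→ℚ-^ m (suc k) = trans (ℕ→ℚ-* m (m ℕ.^ k)) (cong (ℕ→ℚ m *_) (ℕ→ℚ-^ m k))

  ℕ→ℚ-mono-≤ : ∀ {m k} → m ℕ.≤ k → ℕ→ℚ m ≤ ℕ→ℚ k
  ℕ→ℚ-mono-≤ {m} {k} m≤k rewrite ℕ→ℚ≡mkℚ m | ℕ→ℚ≡mkℚ k =
    *≤* (subst₂ ℤ._≤_ (sym (ℤ.*-identityʳ (+ m))) (sym (ℤ.*-identityʳ (+ k))) (ℤ.+≤+ m≤k))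

  ℕ→ℚ-nonNeg : ∀ m → 0ℚ ≤ ℕ→ℚ m
  ℕ→ℚ-nonNeg m = ℕ→ℚ-mono-≤ {0} {m} ℕ.z≤n

  ≤⇒0≤- : ∀ {p q} → p ≤ q → 0ℚ ≤ q - p
  ≤⇒0≤- {p} {q} p≤q = subst (_≤ q - p) (+-inverseʳ p) (+-monoˡ-≤ (- p) p≤q)

  0≤-⇒≤ : ∀ {p q} → 0ℚ ≤ q - p → p ≤ q
  0≤-⇒≤ {p} {q} 0≤q-p = subst (_≤ q) (+-identityˡ p) (subst (0ℚ + p ≤_) (cancel p q) (+-monoˡ-≤ p 0≤q-p))
    where
    cancel : ∀ p q → q - p + p ≡ q
    cancel = solve 2 (λ p q → q :- p :+ p := q) refl

  *-mono-≤-nonNeg : ∀ {p q r s} → 0ℚ ≤ p → 0ℚ ≤ r → p ≤ q → r ≤ s → p * r ≤ q * s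
  *-mono-≤-nonNeg {p} {q} {r} {s} 0≤p 0≤r p≤q r≤s =
    ≤-trans (*-monoʳ-≤-nonNeg r {{nonNegative 0≤r}} p≤q) (*-monoˡ-≤-nonNeg q {{nonNegative (≤-trans 0≤p p≤q)}} r≤s)

  x≤1⇒x*p≤p : ∀ {x p} → 0ℚ ≤ p → x ≤ 1ℚ → x * p ≤ p
  x≤1⇒x*p≤p {p = p} 0≤p x≤1 = ≤-trans (*-monoʳ-≤-nonNeg p {{nonNegative 0≤p}} x≤1) (≤-reflexive (*-identityˡ p))

  nonNeg-* : ∀ {p q} → 0ℚ ≤ p → 0ℚ ≤ q → 0ℚ ≤ p * q
  nonNeg-* {p} {q} = *-mono-≤-nonNeg {0ℚ} {p} {0ℚ} {q} ≤-refl ≤-refl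

  edgePoly : ℚ → ℚ → ℚ
  edgePoly X Y = X * X * (X * X + Y * Y) * (X * Y + X * Y + Y * Y)

  edgePoly-mono : ∀ {X X′ Y Y′} → 0ℚ ≤ X → 0ℚ ≤ Y → X ≤ X′ → Y ≤ Y′ → edgePoly X Y ≤ edgePoly X′ Y′
  edgePoly-mono 0≤X 0≤Y X≤X′ Y≤Y′ =
    *-mono-≤-nonNeg (nonNeg-* 0≤XX (+-mono-≤ 0≤XX 0≤YY)) (+-mono-≤ (+-mono-≤ 0≤XY 0≤XY) 0≤YY)
      (*-mono-≤-nonNeg 0≤XX (+-mono-≤ 0≤XX 0≤YY) XX≤ (+-mono-≤ XX≤ YY≤))
      (+-mono-≤ (+-mono-≤ XY≤ XY≤) YY≤)
    where
    0≤XX = nonNeg-* 0≤X 0≤X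
    0≤YY = nonNeg-* 0≤Y 0≤Y
    0≤XY = nonNeg-* 0≤X 0≤Y
    XX≤ = *-mono-≤-nonNeg 0≤X 0≤X X≤X′ X≤X′
    YY≤ = *-mono-≤-nonNeg 0≤Y 0≤Y Y≤Y′ Y≤Y′
    XY≤ = *-mono-≤-nonNeg 0≤X 0≤Y X≤X′ Y≤Y′

  ℕ→ℚ-edgePoly : ∀ p q → edgePoly (ℕ→ℚ p) (ℕ→ℚ q) ≡ ℕ→ℚ (edgePolyℕ p q)
  ℕ→ℚ-edgePoly p q = sym (begin
    ℕ→ℚ (p ℕ.* p ℕ.* (p ℕ.* p ℕ.+ q ℕ.* q) ℕ.* (p ℕ.* q ℕ.+ p ℕ.* q ℕ.+ q ℕ.* q))
      ≡⟨ ℕ→ℚ-* (p ℕ.* p ℕ.* (p ℕ.* p ℕ.+ q ℕ.* q)) _ ⟩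
    ℕ→ℚ (p ℕ.* p ℕ.* (p ℕ.* p ℕ.+ q ℕ.* q)) * ℕ→ℚ (p ℕ.* q ℕ.+ p ℕ.* q ℕ.+ q ℕ.* q)
      ≡⟨ cong₂ _*_ (ℕ→ℚ-* (p ℕ.* p) _) cross ⟩
    ℕ→ℚ (p ℕ.* p) * ℕ→ℚ (p ℕ.* p ℕ.+ q ℕ.* q) * (P * Q + P * Q + Q * Q)
      ≡⟨ cong (λ t → t * (P * Q + P * Q + Q * Q)) (cong₂ _*_ (ℕ→ℚ-* p p) squares) ⟩
    edgePoly P Q ∎)
    where
    open ≡-Reasoning
    P = ℕ→ℚ p
    Q = ℕ→ℚ q
    squares : ℕ→ℚ (p ℕ.* p ℕ.+ q ℕ.* q) ≡ P * P + Q * Q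
    squares = trans (ℕ→ℚ-+ (p ℕ.* p) (q ℕ.* q)) (cong₂ _+_ (ℕ→ℚ-* p p) (ℕ→ℚ-* q q))
    cross : ℕ→ℚ (p ℕ.* q ℕ.+ p ℕ.* q ℕ.+ q ℕ.* q) ≡ P * Q + P * Q + Q * Q
    cross = trans (ℕ→ℚ-+ (p ℕ.* q ℕ.+ p ℕ.* q) (q ℕ.* q))
                  (cong₂ _+_ (trans (ℕ→ℚ-+ (p ℕ.* q) (p ℕ.* q)) (cong₂ _+_ (ℕ→ℚ-* p q) (ℕ→ℚ-* p q))) (ℕ→ℚ-* q q))

  8f≡edgePoly : ∀ x N → ℕ→ℚ 8 * (f x * N ^ 6) ≡ edgePoly (x * N) ((1ℚ - x) * N)
  8f≡edgePoly = solve 2 (λ x N →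
    let y = con 1ℚ :- x
        X = x :* N
        Y = y :* N
    in con (ℕ→ℚ 8) :* (con ½ :* (x :* x) :* (con ½ :* (x :* x) :+ con ½ :* (y :* y)) :* (x :* y :+ con ½ :* (y :* y)) :* (N :^ 6))
       := X :* X :* (X :* X :+ Y :* Y) :* (X :* Y :+ X :* Y :+ Y :* Y)) refl

  f-nonNeg : ∀ n x → 0ℚ ≤ x → x ≤ 1ℚ → 0ℚ ≤ f x * ℕ→ℚ (n ℕ.^ 6)
  f-nonNeg n x 0≤x x≤1 = *-cancelˡ-≤-pos (ℕ→ℚ 8)
    (subst (0ℚ ≤_) (sym (trans (cong (λ t → ℕ→ℚ 8 * (f x * t)) (ℕ→ℚ-^ n 6)) (8f≡edgePoly x N)))
      (edgePoly-mono {0ℚ} {x * N} {0ℚ} {(1ℚ - x) * N} ≤-refl ≤-refl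
        (nonNeg-* 0≤x (ℕ→ℚ-nonNeg n)) (nonNeg-* (≤⇒0≤- x≤1) (ℕ→ℚ-nonNeg n))))
    where
    N = ℕ→ℚ n

  complement-≤ : ∀ {A B x} → A ≤ x * (A + B) → (1ℚ - x) * (A + B) ≤ B
  complement-≤ {A} {B} {x} A≤xN = 0≤-⇒≤ (subst (0ℚ ≤_) (complement A B x) (≤⇒0≤- A≤xN))
    where
    complement : ∀ A B x → x * (A + B) - A ≡ B - (1ℚ - x) * (A + B)
    complement = solve 3 (λ A B x → x :* (A :+ B) :- A := B :- (con 1ℚ :- x) :* (A :+ B)) refl

  split-bound : ∀ {n e₁ e₂ e₃} a b x → a ℕ.+ b ≡ n → 0ℚ ≤ x → x ≤ 1ℚ →
    ℕ→ℚ a ≤ x * ℕ→ℚ n → x * ℕ→ℚ n ≤ ℕ→ℚ (suc a) →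
    2 ℕ.* e₁ ℕ.+ a ≡ a ℕ.* a → 2 ℕ.* e₂ ℕ.+ (a ℕ.+ b) ≡ a ℕ.* a ℕ.+ b ℕ.* b →
    2 ℕ.* e₃ ℕ.+ b ≡ b ℕ.* b ℕ.+ 2 ℕ.* (a ℕ.* b) →
    f x * ℕ→ℚ (n ℕ.^ 6) ≤ ℕ→ℚ (e₁ ℕ.* e₂ ℕ.* e₃) + ℕ→ℚ (errorTerm n)
  split-bound {e₁ = e₁} {e₂} {e₃} a b x refl 0≤x x≤1 A≤X X≤A+1 h₁ h₂ h₃ = *-cancelˡ-≤-pos (ℕ→ℚ 8) (begin
    ℕ→ℚ 8 * (f x * ℕ→ℚ (n ℕ.^ 6))         ≡⟨ cong (λ t → ℕ→ℚ 8 * (f x * t)) (ℕ→ℚ-^ n 6) ⟩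
    ℕ→ℚ 8 * (f x * N ^ 6)                 ≡⟨ 8f≡edgePoly x N ⟩
    edgePoly (x * N) ((1ℚ - x) * N)       ≤⟨ edgePoly-mono 0≤X 0≤Y X≤A+1 Y≤B ⟩
    edgePoly (ℕ→ℚ (suc a)) (ℕ→ℚ b)        ≡⟨ ℕ→ℚ-edgePoly (suc a) b ⟩
    ℕ→ℚ (edgePolyℕ (suc a) b)             ≤⟨ ℕ→ℚ-mono-≤ (edgePolyℕ-≤ {e₁} {e₂} {e₃} a b h₁ h₂ h₃) ⟩
    ℕ→ℚ (8 ℕ.* (P ℕ.+ errorTerm n))       ≡⟨ trans (ℕ→ℚ-* 8 (P ℕ.+ errorTerm n)) (cong (ℕ→ℚ 8 *_) (ℕ→ℚ-+ P (errorTerm n))) ⟩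
    ℕ→ℚ 8 * (ℕ→ℚ P + ℕ→ℚ (errorTerm n))   ∎)
    where
    open ≤-Reasoning
    n = a ℕ.+ b
    N = ℕ→ℚ n
    P = e₁ ℕ.* e₂ ℕ.* e₃
    0≤X = nonNeg-* 0≤x (ℕ→ℚ-nonNeg n)
    0≤Y = nonNeg-* (≤⇒0≤- x≤1) (ℕ→ℚ-nonNeg n)
    Y≤B : (1ℚ - x) * N ≤ ℕ→ℚ b
    Y≤B = subst (λ M → (1ℚ - x) * M ≤ ℕ→ℚ b) (sym (ℕ→ℚ-+ a b))
                (complement-≤ {ℕ→ℚ a} {ℕ→ℚ b} {x} (subst (λ M → ℕ→ℚ a ≤ x * M) (ℕ→ℚ-+ a b) A≤X))

  floor-within : ∀ n {X} → 0ℚ ≤ X → X ≤ ℕ→ℚ n → Σ ℕ λ a → a ℕ.≤ n × ℕ→ℚ a ≤ X × X ≤ ℕ→ℚ (suc a)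
  floor-within zero    0≤X X≤0 = 0 , ℕ.z≤n , 0≤X , ≤-trans X≤0 (ℕ→ℚ-mono-≤ {0} {1} ℕ.z≤n)
  floor-within (suc n) {X} 0≤X X≤n+1 with X ≤? ℕ→ℚ n
  ... | yes X≤n = let a , a≤n , lower , upper = floor-within n 0≤X X≤n
                  in a , ℕ.m≤n⇒m≤1+n a≤n , lower , upper
  ... | no  X≰n = n , ℕ.n≤1+n n , <⇒≤ (≰⇒> X≰n) , X≤n+1

  +-cancelʳ-≤ : ∀ {p q r} → p + r ≤ q + r → p ≤ q
  +-cancelʳ-≤ {p} {q} {r} p+r≤q+r = 0≤-⇒≤ (subst (0ℚ ≤_) (difference p q r) (≤⇒0≤- p+r≤q+r))
    where
    difference : ∀ p q r → q + r - (p + r) ≡ q - p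
    difference = solve 3 (λ p q r → q :+ r :- (p :+ r) := q :- p) refl

  -- Either the error R is at most εF, or F < KR ≤ P.
  absorb-error : ∀ {F P R ε K} → 0ℚ ≤ F → 0ℚ ≤ ε → 0ℚ ≤ K → 1ℚ ≤ ε * K →
                 F ≤ P + R → K * R ≤ P → F * (1ℚ - ε) ≤ P
  absorb-error {F} {P} {R} {ε} {K} 0≤F 0≤ε 0≤K 1≤εK F≤P+R KR≤P with R ≤? ε * F
  ... | yes R≤εF = 0≤-⇒≤ (subst (0ℚ ≤_) (small-error P R F ε)
                     (+-mono-≤ (≤⇒0≤- F≤P+R) (≤⇒0≤- R≤εF)))
    where
    small-error : ∀ P R F ε → P + R - F + (ε * F - R) ≡ P - F * (1ℚ - ε)
    small-error = solve 4 (λ P R F ε → P :+ R :- F :+ (ε :* F :- R) := P :- F :* (con 1ℚ :- ε)) refl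
  ... | no  R≰εF = 0≤-⇒≤ (subst (0ℚ ≤_) (large-error P R F ε K)
                     (+-mono-≤ (+-mono-≤ (+-mono-≤ (≤⇒0≤- KR≤P) (nonNeg-* 0≤K (≤⇒0≤- (<⇒≤ (≰⇒> R≰εF)))))
                                         (nonNeg-* (≤⇒0≤- 1≤εK) 0≤F))
                               (nonNeg-* 0≤ε 0≤F)))
    where
    large-error : ∀ P R F ε K → P - K * R + K * (R - ε * F) + (ε * K - 1ℚ) * F + ε * F ≡ P - F * (1ℚ - ε)
    large-error = solve 5 (λ P R F ε K →
      P :- K :* R :+ K :* (R :- ε :* F) :+ (ε :* K :- con 1ℚ) :* F :+ ε :* F := P :- F :* (con 1ℚ :- ε)) refl

  archimedean : ∀ {ε} → 0ℚ < ε → Σ ℕ λ k → 1ℚ ≤ ε * ℕ→ℚ k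
  archimedean {ε@(mkℚ +[1+ p ] d _)} _ = suc d , (begin
    1ℚ              ≡⟨ sym (*-inverseʳ ε) ⟩
    ε * 1/ ε        ≤⟨ *-monoˡ-≤-nonNeg ε {{_}} 1/ε≤1+d ⟩
    ε * ℕ→ℚ (suc d) ∎)
    where
    open ≤-Reasoning
    1/ε≤1+d : 1/ ε ≤ ℕ→ℚ (suc d)
    1/ε≤1+d rewrite ℕ→ℚ≡mkℚ (suc d) = *≤* (subst₂ ℤ._≤_ (sym (ℤ.*-identityʳ (+ suc d))) (ℤ.pos-* (suc d) (suc p))
                                                 (ℤ.+≤+ (ℕ.m≤m*n (suc d) (suc p))))
  archimedean {mkℚ (+ 0)    _ _} 0<ε with () ← positive 0<ε
  archimedean {mkℚ -[1+ _ ] _ _} 0<ε with () ← positive 0<ε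

  errorTerm-negligible : ∀ k n → 8192 ℕ.* suc k ℕ.≤ n →
    ℕ→ℚ k * ℕ→ℚ (errorTerm n) + ℕ→ℚ (errorTerm n) ≤ f ½ * ℕ→ℚ (n ℕ.^ 6)
  errorTerm-negligible k n h = *-cancelˡ-≤-pos (ℕ→ℚ 256) (begin
    ℕ→ℚ 256 * (ℕ→ℚ k * R + R)       ≡⟨ cong (ℕ→ℚ 256 *_) (cong (_+ R) (sym (ℕ→ℚ-* k E))) ⟩
    ℕ→ℚ 256 * (ℕ→ℚ (k ℕ.* E) + R)   ≡⟨ sym (trans (ℕ→ℚ-* 256 (k ℕ.* E ℕ.+ E)) (cong (ℕ→ℚ 256 *_) (ℕ→ℚ-+ (k ℕ.* E) E))) ⟩
    ℕ→ℚ (256 ℕ.* (k ℕ.* E ℕ.+ E))   ≤⟨ ℕ→ℚ-mono-≤ (errorTerm-small k n h) ⟩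
    ℕ→ℚ (3 ℕ.* n ℕ.^ 6)             ≡⟨ ℕ→ℚ-* 3 (n ℕ.^ 6) ⟩
    ℕ→ℚ 3 * ℕ→ℚ (n ℕ.^ 6)           ≡⟨ f½ (ℕ→ℚ (n ℕ.^ 6)) ⟩
    ℕ→ℚ 256 * (f ½ * ℕ→ℚ (n ℕ.^ 6)) ∎)
    where
    open ≤-Reasoning
    E = errorTerm n
    R = ℕ→ℚ E
    f½ : ∀ t → ℕ→ℚ 3 * t ≡ ℕ→ℚ 256 * (f ½ * t)
    f½ = solve 1 (λ t → con (ℕ→ℚ 3) :* t := con (ℕ→ℚ 256) :* (con (f ½) :* t)) refl

open import Defs
open import Data.Nat using (ℕ; _≥_)
open import Data.Product using (Σ; _×_)
open import Data.Rational using (ℚ; _≤_; _<_; _*_; _-_; 0ℚ; 1ℚ)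

import Data.Nat as ℕ
import Data.Nat.Properties as ℕ
import Data.Integer.Base as ℤ
open import Data.List.Base using (upTo)
open import Data.List.Extrema ℕ.≤-totalOrder using (argmax; f[xs]≤f[argmax])
open import Data.List.Membership.Propositional.Properties using (∈-upTo⁺)
open import Data.List.Relation.Unary.All using (lookup)
open import Data.Product using (_,_)
open import Data.Rational using (½; _+_; *≤*)
open import Data.Rational.Properties using (≤-trans; <⇒≤; +-monoˡ-≤)
open ThresholdGraphs using (G₁; G₂; G₃; noRainbowTriangle; e-G₁; e-G₂; e-G₃)
open NatBounds using (errorTerm)
open RationalBounds

edgeProduct : ℕ → ℕ → ℕ
edgeProduct n a = e (G₁ n a) ℕ.* e (G₂ n a) ℕ.* e (G₃ n a)

bestSplit : ℕ → ℕ
bestSplit n = argmax (edgeProduct n) 0 (upTo (ℕ.suc n))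

edgeProduct-≤-bestSplit : ∀ {n a} → a ℕ.≤ n → edgeProduct n a ℕ.≤ edgeProduct n (bestSplit n)
edgeProduct-≤-bestSplit {n} a≤n =
  lookup (f[xs]≤f[argmax] {f = edgeProduct n} 0 (upTo (ℕ.suc n))) (∈-upTo⁺ (ℕ.s≤s a≤n))

product-bound : ∀ n x → 0ℚ ≤ x → x ≤ 1ℚ →
  f x * ℕ→ℚ (n ℕ.^ 6) ≤ ℕ→ℚ (edgeProduct n (bestSplit n)) + ℕ→ℚ (errorTerm n)
product-bound n x 0≤x x≤1 =
  let a , a≤n , A≤X , X≤A+1 =
        floor-within n (nonNeg-* 0≤x (ℕ→ℚ-nonNeg n)) (x≤1⇒x*p≤p (ℕ→ℚ-nonNeg n) x≤1)
      b = n ℕ.∸ a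
      a+b≡n = ℕ.m+[n∸m]≡n a≤n
  in ≤-trans (split-bound {n} {e (G₁ n a)} {e (G₂ n a)} {e (G₃ n a)} a b x a+b≡n 0≤x x≤1 A≤X X≤A+1
                           (e-G₁ a b a+b≡n) (e-G₂ a b a+b≡n) (e-G₃ a b a+b≡n))
             (+-monoˡ-≤ (ℕ→ℚ (errorTerm n)) (ℕ→ℚ-mono-≤ (edgeProduct-≤-bestSplit a≤n)))

theorem2 : (ε : ℚ) → 0ℚ < ε →
    Σ ℕ λ N → (n : ℕ) → n ≥ N →
      Σ (Graph n) λ G₁ → Σ (Graph n) λ G₂ → Σ (Graph n) λ G₃ →
        NoRainbowTriangle G₁ G₂ G₃ ×
        ((x : ℚ) → 0ℚ ≤ x → x ≤ 1ℚ →
          f x * ℕ→ℚ (n Data.Nat.^ 6) * (1ℚ - ε) ≤ ℕ→ℚ (e G₁ Data.Nat.* e G₂ Data.Nat.* e G₃))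
theorem2 ε 0<ε =
  let k , 1≤εk = archimedean 0<ε in
  8192 ℕ.* ℕ.suc k , λ n n≥N →
    let m = bestSplit n in
    G₁ n m , G₂ n m , G₃ n m , noRainbowTriangle n m , λ x 0≤x x≤1 →
      absorb-error (f-nonNeg n x 0≤x x≤1) (<⇒≤ 0<ε) (ℕ→ℚ-nonNeg k) 1≤εk (product-bound n x 0≤x x≤1)
        (+-cancelʳ-≤ (≤-trans (errorTerm-negligible k n n≥N) (product-bound n ½ 0≤½ ½≤1)))
  where
  0≤½ : 0ℚ ≤ ½
  0≤½ = *≤* (ℤ.+≤+ ℕ.z≤n)
  ½≤1 : ½ ≤ 1ℚ
  ½≤1 = *≤* (ℤ.+≤+ (ℕ.s≤s ℕ.z≤n))
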